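{- For every $r\in\mathbb{N}$ and every $n\in\mathbb{N}$ with $n\le 4$, the generalized glued binary tree $GT^{(n)}_{r,2}$ is an AR-graph.
   Context: All graphs are finite, simple and undirected; $\mathbb{N}=\{1,2,3,\dots\}$. For $t\ge 2$ and $r\ge 1$, the perfect $t$-ary tree $T_{r,t}$ is the rooted tree in which every interior vertex has exactly $t$ children and all leaves have depth $r$ (number of edges from the root). The $n$-th generalized glued $t$-ary tree $GT^{(n)}_{r,t}$ of depth $r$ is obtained from $n$ disjoint copies of $T_{r,t}$ by identifying, for each leaf of $T_{r,t}$, its $n$ copies into a single vertex (for $n=2$ this is the glued tree $GT(r,t)$). Let $f:E(G)\to\mathbb{N}$ be an injective edge labeling of a graph $G$. A vertex $v$ is an AR-vertex (under $f$) if, whenever $x_1,\dots,x_k$ are the labels of the $k$ edges incident on $v$, the $2^k$ sums $\sum_{i\in S}x_i$ over all subsets $S\subseteq\{1,\dots,k\}$ are pairwise distinct. An injective labeling $f$ is an AR-labeling if every vertex is an AR-vertex under $f$. A graph $G$ with $m$ edges is an AR-graph if it has an AR-labeling $f:E(G)\to\{1,2,\dots,m\}$. -}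

module Defs where

open import Data.Nat using (ℕ; zero; suc; _+_; _≤_; _≡ᵇ_)
open import Data.Bool using (Bool; true; false; if_then_else_)
open import Data.Fin using (Fin)
open import Data.Fin.Subset using (Subset; _∈_)
open import Data.List using (List; []; _∷_; length; lookup; map; concatMap; upTo; allFin)
open import Data.Vec using (tabulate; sum)
import Data.Vec as Vec
open import Data.Product using (_×_; _,_; proj₁; proj₂; Σ-syntax; ∃-syntax)
open import Data.Sum using (_⊎_)
open import Relation.Binary.PropositionalEquality using (_≡_)
open import Function.Definitions using (Injective)

module _ {V : Set} (E : List (V × V)) where

  edgeCount : ℕ
  edgeCount = length E

  Incident : V → Fin edgeCount → Set
  Incident v e = proj₁ (lookup E e) ≡ v ⊎ proj₂ (lookup E e) ≡ v

  subsetSum : (Fin edgeCount → ℕ) → Subset edgeCount → ℕ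
  subsetSum f S = sum (tabulate λ e → if Vec.lookup S e then f e else 0)

  IsARVertex : (Fin edgeCount → ℕ) → V → Set
  IsARVertex f v = (S T : Subset edgeCount) →
    (∀ e → e ∈ S → Incident v e) →
    (∀ e → e ∈ T → Incident v e) →
    subsetSum f S ≡ subsetSum f T → S ≡ T

  IsARLabeling : (Fin edgeCount → ℕ) → Set
  IsARLabeling f = Injective _≡_ _≡_ f × (∀ v → IsARVertex f v)

  IsARGraph : Set
  IsARGraph = ∃[ f ] ((∀ e → 1 ≤ f e × f e ≤ edgeCount) × IsARLabeling f)

-- A node of the perfect binary tree T_{r,2} is a binary string (List Bool)
-- of length ≤ r (the root is [], children of w are false ∷ w, true ∷ w).
-- Non-leaf nodes exist once per copy i : Fin n; leaves (length r) are shared.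

data GTVertex (n : ℕ) : Set where
  inner : Fin n → List Bool → GTVertex n
  leaf  : List Bool → GTVertex n

allStrings : ℕ → List (List Bool)
allStrings zero    = [] ∷ []
allStrings (suc k) = concatMap (λ w → (false ∷ w) ∷ (true ∷ w) ∷ []) (allStrings k)

node : (n r : ℕ) → Fin n → List Bool → GTVertex n
node n r i w = if length w ≡ᵇ r then leaf w else inner i w

gluedEdges : (n r : ℕ) → List (GTVertex n × GTVertex n)
gluedEdges n r =
  concatMap (λ i →
    concatMap (λ d →
      concatMap (λ w →
        map (λ b → (inner i w , node n r i (b ∷ w))) (false ∷ true ∷ []))
      (allStrings d))
    (upTo r))
  (allFin n)

-- Let Q = 2^(r-1) be the number of nodes just above the leaves, so that there are M = n(4Q - 2)
-- edges. The 2nQ edges into leaves get the labels 1, …, 2nQ: the edge of copy i from the node with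
-- level index K to its b-child gets 2nK + P(b, i), where the palette P is a bijection from
-- Bool × Fin n onto {1, …, 2n}. The other edges get 2nQ + 1, …, M in breadth-first order.
-- The labels at a leaf form a column of the palette shifted by 2nK; a shift exceeding the sum of
-- the column preserves dissociation, so only the shifts with K ≤ n have to be checked.
-- An inner vertex has at most three edges and is an AR-vertex as soon as no label there is the sum
-- of the other two. Below the last level all three labels lie in (2nQ, 4nQ). At the last level the
-- parent label is 4nK + 3nt + n + i + 1 with t = Q - 1 - K, while the two leaf labels sum to
-- 4nK + P(false, i) + P(true, i) ≤ 4nK + 4n; the palette is chosen so that these never meet.
-- The palettes used for n = 1, …, 4 are verified by computation.

module Submission where

open import Defs
open import Data.Nat using (ℕ; zero; suc; _+_; _*_; _^_; _≤_; _<_; z≤n; s≤s; z<s; _≟_; _<?_; _≤?_; _≡ᵇ_)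
open import Data.Nat.Properties
open import Data.Nat.ListAction using (sum)
open import Data.Nat.ListAction.Properties using (sum-++)
open import Data.Bool using (Bool; true; false; if_then_else_; T)
import Data.Bool.Properties as Boolₚ
open import Data.Empty using (⊥-elim)
open import Data.Product as Product using (_×_; _,_; proj₁; proj₂; ∃-syntax)
open import Data.Sum using (_⊎_; inj₁; inj₂)
open import Data.List using (List; []; _∷_; _++_; _∷ʳ_; length; map; concatMap; lookup; drop; upTo; allFin)
open import Data.List.Properties
  using ( ≡-dec; length-++; length-map; length-tabulate; map-id; map-cong; map-∘; map-cong-local; map-++
        ; upTo-∷ʳ; ∷-injectiveˡ; ∷-injectiveʳ)
open import Data.List.Membership.Propositional using (_∈_; _∉_; find)
open import Data.List.Membership.Propositional.Properties
  using (∈-concatMap⁻; ∈-concatMap⁺; ∈-map⁺; ∈-map⁻; ∈-lookup; ∈-upTo⁻; ∈-upTo⁺; ∈-allFin)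
open import Data.List.Relation.Unary.Any as Any using (here; there)
import Data.List.Relation.Unary.Any.Properties as Anyₚ
open import Data.List.Relation.Unary.All as All using (All; []; _∷_)
import Data.List.Relation.Unary.All.Properties as Allₚ
open import Data.List.Relation.Unary.AllPairs using ([]; _∷_)
open import Data.List.Relation.Unary.Unique.Propositional using (Unique)
import Data.List.Relation.Unary.Unique.Propositional.Properties as Uniqueₚ
open import Data.Fin using (Fin)
import Data.Fin as Fin
import Data.Fin.Properties as Finₚ
open import Data.Vec using (Vec; tabulate; _∷_; [])
open import Data.Vec.Properties using (tabulate∘lookup; tabulate-cong; lookup⇒[]=)
open import Data.Fin.Subset using (Subset)
import Data.Fin.Subset as FS
import Data.Vec as Vec
open import Function using (_∘_; case_of_)
open import Relation.Binary.PropositionalEquality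
open import Relation.Binary.Definitions using (tri<; tri≈; tri>)
open import Relation.Nullary using (¬_; Dec; yes; no)
open import Relation.Nullary.Decidable using (True; map′; _→-dec_; _×-dec_; ¬?; toWitness)
open import Data.Nat.Tactic.RingSolver using (solve-∀)

concatMap-unique : {A B K : Set} (f : A → List B) (key : B → K) (keyOf : A → K) (xs : List A) →
  Unique (map keyOf xs) → (∀ x → All (λ y → key y ≡ keyOf x) (f x)) → (∀ x → Unique (f x)) →
  Unique (concatMap f xs)
concatMap-unique f key keyOf [] _ _ _ = []
concatMap-unique f key keyOf (x ∷ xs) (x∉ ∷ u) keyed fu =
  Uniqueₚ.++⁺ (fu x) (concatMap-unique f key keyOf xs u keyed fu) disjoint
  where
  disjoint : ∀ {y} → ¬ (y ∈ f x × y ∈ concatMap f xs)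
  disjoint (y∈fx , y∈rest) with find (∈-concatMap⁻ f {xs = xs} y∈rest)
  ... | x′ , x′∈ , y∈fx′ = All.lookup x∉ (∈-map⁺ keyOf x′∈)
    (trans (sym (All.lookup (keyed x) y∈fx)) (All.lookup (keyed x′) y∈fx′))

lookup-injective : {A : Set} {xs : List A} → Unique xs → ∀ i j → lookup xs i ≡ lookup xs j → i ≡ j
lookup-injective (x∉ ∷ u) Fin.zero    Fin.zero    _  = refl
lookup-injective (x∉ ∷ u) Fin.zero    (Fin.suc j) eq = ⊥-elim (All.lookup x∉ (∈-lookup j) eq)
lookup-injective (x∉ ∷ u) (Fin.suc i) Fin.zero    eq = ⊥-elim (All.lookup x∉ (∈-lookup i) (sym eq))
lookup-injective (x∉ ∷ u) (Fin.suc i) (Fin.suc j) eq = cong Fin.suc (lookup-injective u i j eq)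

length-concatMap : {A B : Set} (f : A → List B) (xs : List A) →
  length (concatMap f xs) ≡ sum (map (λ x → length (f x)) xs)
length-concatMap f [] = refl
length-concatMap f (x ∷ xs) = trans (length-++ (f x)) (cong (length (f x) +_) (length-concatMap f xs))

sum-map-const : {A : Set} (g : A → ℕ) {c : ℕ} (xs : List A) → (∀ x → g x ≡ c) →
  sum (map g xs) ≡ length xs * c
sum-map-const g [] _ = refl
sum-map-const g (x ∷ xs) gc = cong₂ _+_ (gc x) (sum-map-const g xs gc)

sum-map-≤ : {A : Set} (g : A → ℕ) {c : ℕ} (xs : List A) → (∀ x → g x ≤ c) →
  sum (map g xs) ≤ length xs * c
sum-map-≤ g [] _ = z≤n
sum-map-≤ g (x ∷ xs) gc = +-mono-≤ (gc x) (sum-map-≤ g xs gc)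

-- Binary strings

allStrings-length : ∀ d {w} → w ∈ allStrings d → length w ≡ d
allStrings-length zero (here refl) = refl
allStrings-length (suc d) w∈
  with find (∈-concatMap⁻ (λ w → (false ∷ w) ∷ (true ∷ w) ∷ []) {xs = allStrings d} w∈)
... | w′ , w′∈ , here refl         = cong suc (allStrings-length d w′∈)
... | w′ , w′∈ , there (here refl) = cong suc (allStrings-length d w′∈)

allStrings-complete : ∀ w → w ∈ allStrings (length w)
allStrings-complete [] = here refl
allStrings-complete (b ∷ w) =
  ∈-concatMap⁺ (λ w → (false ∷ w) ∷ (true ∷ w) ∷ []) (Any.map (λ { refl → extend b }) (allStrings-complete w))
  where
  extend : ∀ b → (b ∷ w) ∈ (false ∷ w) ∷ (true ∷ w) ∷ []
  extend false = here refl
  extend true  = there (here refl)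

∈-allStrings : ∀ {d w} → length w ≡ d → w ∈ allStrings d
∈-allStrings {w = w} refl = allStrings-complete w

allStrings-unique : ∀ d → Unique (allStrings d)
allStrings-unique zero = [] ∷ []
allStrings-unique (suc d) =
  concatMap-unique (λ w → (false ∷ w) ∷ (true ∷ w) ∷ []) (drop 1) (λ w → w) (allStrings d)
    (subst Unique (sym (map-id _)) (allStrings-unique d))
    (λ _ → refl ∷ refl ∷ []) (λ _ → ((λ ()) ∷ []) ∷ [] ∷ [])

length-allStrings : ∀ d → length (allStrings d) ≡ 2 ^ d
length-allStrings zero = refl
length-allStrings (suc d) = begin
  length (allStrings (suc d))                                 ≡⟨ length-concatMap _ (allStrings d) ⟩
  sum (map (λ _ → 2) (allStrings d))                          ≡⟨ sum-map-const _ (allStrings d) (λ _ → refl) ⟩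
  length (allStrings d) * 2                                   ≡⟨ cong (_* 2) (length-allStrings d) ⟩
  2 ^ d * 2                                                   ≡⟨ *-comm (2 ^ d) 2 ⟩
  2 ^ suc d                                                   ∎
  where open ≡-Reasoning

-- Dissociated lists

selectSum : List Bool → List ℕ → ℕ
selectSum []      _       = 0
selectSum (_ ∷ _) []      = 0
selectSum (b ∷ s) (x ∷ L) = (if b then x else 0) + selectSum s L

Dissociated : List ℕ → Set
Dissociated L = ∀ s t → length s ≡ length L → length t ≡ length L → selectSum s L ≡ selectSum t L → s ≡ t

dissociated? : ∀ L → Dec (Dissociated L)
dissociated? L = map′ fromTable toTable
  (All.all? (λ s → All.all? (λ t → (selectSum s L ≟ selectSum t L) →-dec ≡-dec Boolₚ._≟_ s t) masks) masks)
  where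
  masks : List (List Bool)
  masks = allStrings (length L)
  fromTable : All (λ s → All (λ t → selectSum s L ≡ selectSum t L → s ≡ t) masks) masks → Dissociated L
  fromTable table s t ls lt = All.lookup (All.lookup table (∈-allStrings ls)) (∈-allStrings lt)
  toTable : Dissociated L → All (λ s → All (λ t → selectSum s L ≡ selectSum t L → s ≡ t) masks) masks
  toTable D = All.tabulate λ s∈ → All.tabulate λ t∈ →
    D _ _ (allStrings-length _ s∈) (allStrings-length _ t∈)

[]-dissociated : Dissociated []
[]-dissociated [] [] _ _ _ = refl

∷-dissociated : ∀ {a L} → Dissociated L →
  (∀ s t → length s ≡ length L → length t ≡ length L → a + selectSum s L ≢ selectSum t L) →
  Dissociated (a ∷ L)
∷-dissociated D new (false ∷ s) (false ∷ t) ls lt eq = cong (false ∷_) (D s t (suc-injective ls) (suc-injective lt) eq)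
∷-dissociated D new (true ∷ s)  (true ∷ t)  ls lt eq =
  cong (true ∷_) (D s t (suc-injective ls) (suc-injective lt) (+-cancelˡ-≡ _ _ _ eq))
∷-dissociated D new (true ∷ s)  (false ∷ t) ls lt eq = ⊥-elim (new s t (suc-injective ls) (suc-injective lt) eq)
∷-dissociated D new (false ∷ s) (true ∷ t)  ls lt eq = ⊥-elim (new t s (suc-injective lt) (suc-injective ls) (sym eq))

pair-dissociated : ∀ {b c} → 0 < b → 0 < c → b ≢ c → Dissociated (b ∷ c ∷ [])
pair-dissociated {b@(suc _)} {c@(suc _)} _ _ b≢c = ∷-dissociated single new
  where
  single : Dissociated (c ∷ [])
  single = ∷-dissociated []-dissociated λ { [] [] _ _ () }
  new : ∀ s t → length s ≡ 1 → length t ≡ 1 → b + selectSum s (c ∷ []) ≢ selectSum t (c ∷ [])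
  new (false ∷ []) (false ∷ []) _ _ ()
  new (false ∷ []) (true ∷ [])  _ _ e = b≢c (+-cancelʳ-≡ 0 _ _ e)
  new (true ∷ [])  (false ∷ []) _ _ ()
  new (true ∷ [])  (true ∷ [])  _ _ e = m≢1+n+m _ (sym e)

triple-dissociated : ∀ {a b c} → 0 < a → 0 < b → 0 < c → a ≢ b → a ≢ c → b ≢ c →
  a ≢ b + c → b ≢ a + c → c ≢ a + b → Dissociated (a ∷ b ∷ c ∷ [])
triple-dissociated {a@(suc _)} {b} {c} _ 0<b 0<c a≢b a≢c b≢c a≢b+c b≢a+c c≢a+b =
  ∷-dissociated (pair-dissociated 0<b 0<c b≢c) new
  where
  a+≢ : ∀ {x} → a + x ≢ x
  a+≢ e = m≢1+n+m _ (sym e)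
  a+≢0 : ∀ {x} → a + x ≢ 0
  a+≢0 ()
  new : ∀ s t → length s ≡ 2 → length t ≡ 2 → a + selectSum s (b ∷ c ∷ []) ≢ selectSum t (b ∷ c ∷ [])
  new (false ∷ false ∷ []) (false ∷ false ∷ []) _ _ ()
  new (false ∷ false ∷ []) (true ∷ false ∷ [])  _ _ e = a≢b (+-cancelʳ-≡ 0 a b e)
  new (false ∷ false ∷ []) (false ∷ true ∷ [])  _ _ e = a≢c (+-cancelʳ-≡ 0 a c e)
  new (false ∷ false ∷ []) (true ∷ true ∷ [])   _ _ e =
    a≢b+c (trans (sym (+-identityʳ a)) (trans e (cong (b +_) (+-identityʳ c))))
  new (true ∷ false ∷ [])  (false ∷ false ∷ []) _ _ ()
  new (true ∷ false ∷ [])  (true ∷ false ∷ [])  _ _ e = a+≢ e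
  new (true ∷ false ∷ [])  (false ∷ true ∷ [])  _ _ e =
    c≢a+b (sym (trans (cong (a +_) (sym (+-identityʳ b))) (trans e (+-identityʳ c))))
  new (true ∷ false ∷ [])  (true ∷ true ∷ [])   _ _ e =
    a≢c (+-cancelˡ-≡ b a c (trans (+-comm b a)
      (trans (cong (a +_) (sym (+-identityʳ b))) (trans e (cong (b +_) (+-identityʳ c))))))
  new (false ∷ true ∷ [])  (false ∷ false ∷ []) _ _ ()
  new (false ∷ true ∷ [])  (true ∷ false ∷ [])  _ _ e =
    b≢a+c (sym (trans (cong (a +_) (sym (+-identityʳ c))) (trans e (+-identityʳ b))))
  new (false ∷ true ∷ [])  (false ∷ true ∷ [])  _ _ e = a+≢ e
  new (false ∷ true ∷ [])  (true ∷ true ∷ [])   _ _ e = a≢b (+-cancelʳ-≡ (c + 0) a b e)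
  new (true ∷ true ∷ [])   (false ∷ false ∷ []) _ _ ()
  new (true ∷ true ∷ [])   (true ∷ false ∷ [])  _ _ e =
    a+≢0 (+-cancelʳ-≡ b (a + (c + 0)) 0
      (trans (trans (+-assoc a _ b) (cong (a +_) (+-comm (c + 0) b))) (trans e (+-comm b 0))))
  new (true ∷ true ∷ [])   (false ∷ true ∷ [])  _ _ e =
    a+≢0 (+-cancelʳ-≡ (c + 0) (a + b) 0 (trans (+-assoc a b _) e))
  new (true ∷ true ∷ [])   (true ∷ true ∷ [])   _ _ e = a+≢ e

selectSum-≤ : ∀ s L → selectSum s L ≤ sum L
selectSum-≤ []          _       = z≤n
selectSum-≤ (_ ∷ _)     []      = z≤n
selectSum-≤ (false ∷ s) (x ∷ L) = ≤-trans (selectSum-≤ s L) (m≤n+m _ x)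
selectSum-≤ (true ∷ s)  (x ∷ L) = +-monoʳ-≤ x (selectSum-≤ s L)

selectSum-shift : ∀ c s L → selectSum s (map (c +_) L) ≡ c * selectSum s (map (λ _ → 1) L) + selectSum s L
selectSum-shift c []          _       = sym (trans (+-identityʳ _) (*-zeroʳ c))
selectSum-shift c (_ ∷ _)     []      = sym (trans (+-identityʳ _) (*-zeroʳ c))
selectSum-shift c (false ∷ s) (x ∷ L) = selectSum-shift c s L
selectSum-shift c (true ∷ s)  (x ∷ L) = begin
  c + x + selectSum s (map (c +_) L)   ≡⟨ cong (c + x +_) (selectSum-shift c s L) ⟩
  c + x + (c * k + selectSum s L)      ≡⟨ regroup c x k _ ⟩
  c * (1 + k) + (x + selectSum s L)    ∎
  where
  open ≡-Reasoning
  k : ℕ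
  k = selectSum s (map (λ _ → 1) L)
  regroup : ∀ c x k d → c + x + (c * k + d) ≡ c * (1 + k) + (x + d)
  regroup = solve-∀

*+-< : ∀ q {k k′ a a′} → a < q → k < k′ → q * k + a < q * k′ + a′
*+-< q {k} {k′} {a} {a′} a<q k<k′ = begin-strict
  q * k + a    <⟨ +-monoʳ-< (q * k) a<q ⟩
  q * k + q    ≡⟨ trans (+-comm (q * k) q) (sym (*-suc q k)) ⟩
  q * suc k    ≤⟨ *-monoʳ-≤ q k<k′ ⟩
  q * k′       ≤⟨ m≤m+n (q * k′) a′ ⟩
  q * k′ + a′  ∎
  where open ≤-Reasoning

*+-injective : ∀ q {k k′ a a′} → a < q → a′ < q → q * k + a ≡ q * k′ + a′ → k ≡ k′ × a ≡ a′
*+-injective q {k} {k′} a<q a′<q eq with <-cmp k k′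
... | tri≈ _ refl _ = refl , +-cancelˡ-≡ (q * k) _ _ eq
... | tri< k<k′ _ _ = ⊥-elim (<⇒≢ (*+-< q a<q k<k′) eq)
... | tri> _ _ k′<k = ⊥-elim (<⇒≢ (*+-< q a′<q k′<k) (sym eq))

*+-injective⁺ : ∀ q {k k′ a a′} → 0 < a → a ≤ q → 0 < a′ → a′ ≤ q →
  q * k + a ≡ q * k′ + a′ → k ≡ k′ × a ≡ a′
*+-injective⁺ q {k} {k′} {suc a} {suc a′} _ a<q _ a′<q eq = Product.map₂ (cong suc)
  (*+-injective q a<q a′<q (suc-injective (trans (sym (+-suc (q * k) a)) (trans eq (+-suc (q * k′) a′)))))

-- Shifting every entry by more than the total sum fixes the number of selected entries,
-- so equal shifted sums force equal unshifted ones.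
shift-dissociated : ∀ {c L} → sum L < c → Dissociated L → Dissociated (map (c +_) L)
shift-dissociated {c} {L} ΣL<c D s t ls lt eq =
  D s t (trans ls (length-map _ L)) (trans lt (length-map _ L)) (proj₂ (*+-injective c
    (≤-<-trans (selectSum-≤ s L) ΣL<c) (≤-<-trans (selectSum-≤ t L) ΣL<c)
    (trans (sym (selectSum-shift c s L)) (trans eq (selectSum-shift c t L)))))

shifts-dissociated : ∀ q b {L} → sum L < q * b → (∀ (k : Fin b) → Dissociated (map (q * Fin.toℕ k +_) L)) →
  ∀ k → Dissociated (map (q * k +_) L)
shifts-dissociated q zero {L} ΣL<q0 _ _ = ⊥-elim (n≮0 (subst (sum L <_) (*-zeroʳ q) ΣL<q0))
shifts-dissociated q (suc b) {L} ΣL<qb small k with k <? suc b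
... | yes k<b = subst (λ j → Dissociated (map (q * j +_) L)) (Finₚ.toℕ-fromℕ< k<b) (small (Fin.fromℕ< k<b))
... | no k≮b = shift-dissociated (<-≤-trans ΣL<qb (*-monoʳ-≤ q (≮⇒≥ k≮b)))
  (subst Dissociated (trans (map-cong (λ x → cong (_+ x) (*-zeroʳ q)) L) (map-id L)) (small Fin.zero))

-- Sums over Fin m supported on a list

zeroAt : ∀ {m} → Fin m → (Fin m → ℕ) → Fin m → ℕ
zeroAt Fin.zero    h Fin.zero    = 0
zeroAt Fin.zero    h (Fin.suc e) = h (Fin.suc e)
zeroAt (Fin.suc _) h Fin.zero    = h Fin.zero
zeroAt (Fin.suc e₀) h (Fin.suc e) = zeroAt e₀ (h ∘ Fin.suc) e

zeroAt-self : ∀ {m} e (h : Fin m → ℕ) → zeroAt e h e ≡ 0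
zeroAt-self Fin.zero    h = refl
zeroAt-self (Fin.suc e) h = zeroAt-self e (h ∘ Fin.suc)

zeroAt-other : ∀ {m} {e₀ e} (h : Fin m → ℕ) → e₀ ≢ e → zeroAt e₀ h e ≡ h e
zeroAt-other {e₀ = Fin.zero}    {Fin.zero}    h e₀≢e = ⊥-elim (e₀≢e refl)
zeroAt-other {e₀ = Fin.zero}    {Fin.suc e}   h _    = refl
zeroAt-other {e₀ = Fin.suc e₀} {Fin.zero}    h _    = refl
zeroAt-other {e₀ = Fin.suc e₀} {Fin.suc e}   h e₀≢e = zeroAt-other (h ∘ Fin.suc) (e₀≢e ∘ cong Fin.suc)

sum-tabulate-zeroAt : ∀ {m} e (h : Fin m → ℕ) → Vec.sum (tabulate h) ≡ h e + Vec.sum (tabulate (zeroAt e h))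
sum-tabulate-zeroAt Fin.zero    h = refl
sum-tabulate-zeroAt (Fin.suc e) h = begin
  h Fin.zero + Vec.sum (tabulate (h ∘ Fin.suc))
    ≡⟨ cong (h Fin.zero +_) (sum-tabulate-zeroAt e (h ∘ Fin.suc)) ⟩
  h Fin.zero + (h (Fin.suc e) + Vec.sum (tabulate (zeroAt e (h ∘ Fin.suc))))
    ≡⟨ +-left-comm (h Fin.zero) (h (Fin.suc e)) _ ⟩
  h (Fin.suc e) + (h Fin.zero + Vec.sum (tabulate (zeroAt e (h ∘ Fin.suc)))) ∎
  where
  open ≡-Reasoning
  +-left-comm : ∀ x y z → x + (y + z) ≡ y + (x + z)
  +-left-comm = solve-∀

sum-tabulate-zero : ∀ {m} (h : Fin m → ℕ) → (∀ e → h e ≡ 0) → Vec.sum (tabulate h) ≡ 0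
sum-tabulate-zero {zero}  h h≡0 = refl
sum-tabulate-zero {suc m} h h≡0 = cong₂ _+_ (h≡0 Fin.zero) (sum-tabulate-zero (h ∘ Fin.suc) (h≡0 ∘ Fin.suc))

sum-tabulate-support : ∀ {m} (h : Fin m → ℕ) ys → Unique ys → (∀ e → e ∉ ys → h e ≡ 0) →
  Vec.sum (tabulate h) ≡ sum (map h ys)
sum-tabulate-support h []        _          h≡0 = sum-tabulate-zero h (λ e → h≡0 e (λ ()))
sum-tabulate-support h (e₀ ∷ ys) (e₀∉ ∷ u) h≡0 = begin
  Vec.sum (tabulate h)                     ≡⟨ sum-tabulate-zeroAt e₀ h ⟩
  h e₀ + Vec.sum (tabulate (zeroAt e₀ h))  ≡⟨ cong (h e₀ +_) (sum-tabulate-support (zeroAt e₀ h) ys u vanishes) ⟩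
  h e₀ + sum (map (zeroAt e₀ h) ys)
    ≡⟨ cong (λ l → h e₀ + sum l) (map-cong-local (All.map (zeroAt-other h) e₀∉)) ⟩
  h e₀ + sum (map h ys)                    ∎
  where
  open ≡-Reasoning
  vanishes : ∀ e → e ∉ ys → zeroAt e₀ h e ≡ 0
  vanishes e e∉ with e₀ Fin.≟ e
  ... | yes refl = zeroAt-self e₀ h
  ... | no e₀≢e =
    trans (zeroAt-other h e₀≢e) (h≡0 e λ { (here e≡e₀) → e₀≢e (sym e≡e₀) ; (there e∈) → e∉ e∈ })

-- AR vertices

map-≡⇒∈⇒≡ : {A B : Set} {g h : A → B} {xs : List A} {x : A} → map g xs ≡ map h xs → x ∈ xs → g x ≡ h x
map-≡⇒∈⇒≡ {xs = _ ∷ _} eq (here refl) = ∷-injectiveˡ eq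
map-≡⇒∈⇒≡ {xs = _ ∷ _} eq (there x∈) = map-≡⇒∈⇒≡ (∷-injectiveʳ eq) x∈

module _ {m : ℕ} (f : Fin m → ℕ) {ys : List (Fin m)} (ys-unique : Unique ys) where

  private
    selected : Subset m → Fin m → ℕ
    selected S e = if Vec.lookup S e then f e else 0

  ∉-support : (S : Subset m) → (∀ e → e FS.∈ S → e ∈ ys) → ∀ e → e ∉ ys → Vec.lookup S e ≡ false
  ∉-support S S⊆ys e e∉ with Vec.lookup S e in S[e]
  ... | true  = ⊥-elim (e∉ (S⊆ys e (lookup⇒[]= e S S[e])))
  ... | false = refl

  sum-selected : (S : Subset m) → (∀ e → e FS.∈ S → e ∈ ys) →
    Vec.sum (tabulate (selected S)) ≡ selectSum (map (Vec.lookup S) ys) (map f ys)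
  sum-selected S S⊆ys = trans (sum-tabulate-support (selected S) ys ys-unique vanishes) (selectSum-map ys)
    where
    vanishes : ∀ e → e ∉ ys → selected S e ≡ 0
    vanishes e e∉ rewrite ∉-support S S⊆ys e e∉ = refl
    selectSum-map : ∀ zs → sum (map (selected S) zs) ≡ selectSum (map (Vec.lookup S) zs) (map f zs)
    selectSum-map []       = refl
    selectSum-map (z ∷ zs) = cong (selected S z +_) (selectSum-map zs)

  subsets-determined : Dissociated (map f ys) → (S T : Subset m) →
    (∀ e → e FS.∈ S → e ∈ ys) → (∀ e → e FS.∈ T → e ∈ ys) →
    Vec.sum (tabulate (selected S)) ≡ Vec.sum (tabulate (selected T)) → S ≡ T
  subsets-determined D S T S⊆ys T⊆ys eq =
    trans (sym (tabulate∘lookup S)) (trans (tabulate-cong pointwise) (tabulate∘lookup T))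
    where
    sameOnYs : map (Vec.lookup S) ys ≡ map (Vec.lookup T) ys
    sameOnYs = D _ _ (trans (length-map _ ys) (sym (length-map f ys))) (trans (length-map _ ys) (sym (length-map f ys)))
      (trans (sym (sum-selected S S⊆ys)) (trans eq (sum-selected T T⊆ys)))
    pointwise : ∀ e → Vec.lookup S e ≡ Vec.lookup T e
    pointwise e with Any.any? (e Fin.≟_) ys
    ... | yes e∈ = map-≡⇒∈⇒≡ sameOnYs e∈
    ... | no  e∉ = trans (∉-support S S⊆ys e e∉) (sym (∉-support T T⊆ys e e∉))

isARVertex-from-dissociated : {V : Set} (E : List (V × V)) (f : Fin (edgeCount E) → ℕ) (v : V)
  {ys : List (Fin (edgeCount E))} →
  Unique ys → (∀ e → Incident E v e → e ∈ ys) → Dissociated (map f ys) → IsARVertex E f v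
isARVertex-from-dissociated E f v ys-unique incident⊆ys D S T S⊆ T⊆ =
  subsets-determined f ys-unique D S T
    (λ e e∈S → incident⊆ys e (S⊆ e e∈S)) (λ e e∈T → incident⊆ys e (T⊆ e e∈T))

isARVertex-from-edges : {V : Set} (E : List (V × V)) → Unique E → (Λ : V × V → ℕ) (v : V) {xs : List (V × V)} →
  All (_∈ E) xs → Unique xs → (∀ e → Incident E v e → lookup E e ∈ xs) → Dissociated (map Λ xs) →
  IsARVertex E (Λ ∘ lookup E) v
isARVertex-from-edges E E-unique Λ v {xs} xs⊆E xs-unique incident⊆xs D =
  isARVertex-from-dissociated E (Λ ∘ lookup E) v ys-unique incident⊆ys
    (subst Dissociated (trans (cong (map Λ) (sym lookup-ys)) (sym (map-∘ ys))) D)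
  where
  ys : List (Fin (edgeCount E))
  ys = All.reduce Any.index xs⊆E
  lookup-ys : map (lookup E) ys ≡ xs
  lookup-ys = go xs⊆E
    where
    go : ∀ {zs} (zs⊆E : All (_∈ E) zs) → map (lookup E) (All.reduce Any.index zs⊆E) ≡ zs
    go []             = refl
    go (z∈E ∷ zs⊆E) = cong₂ _∷_ (sym (Anyₚ.lookup-index z∈E)) (go zs⊆E)
  ys-unique : Unique ys
  ys-unique = Uniqueₚ.map⁻ (subst Unique (sym lookup-ys) xs-unique)
  incident⊆ys : ∀ e → Incident E v e → e ∈ ys
  incident⊆ys e inc with ∈-map⁻ (lookup E) (subst (lookup E e ∈_) (sym lookup-ys) (incident⊆xs e inc))
  ... | e′ , e′∈ , same = subst (_∈ ys) (sym (lookup-injective E-unique e e′ same)) e′∈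

-- Numbering the nodes of the binary tree

appendBit : Bool → ℕ → ℕ
appendBit false x = 2 * x
appendBit true  x = suc (2 * x)

appendBit-injective : ∀ {b b′ x x′} → appendBit b x ≡ appendBit b′ x′ → b ≡ b′ × x ≡ x′
appendBit-injective {false} {false} {x} {x′} eq = refl , *-cancelˡ-≡ x x′ 2 eq
appendBit-injective {true}  {true}  {x} {x′} eq = refl , *-cancelˡ-≡ x x′ 2 (suc-injective eq)
appendBit-injective {false} {true}  {x} {x′} eq = ⊥-elim (even≢odd x x′ eq)
appendBit-injective {true}  {false} {x} {x′} eq = ⊥-elim (even≢odd x′ x (sym eq))

appendBit-< : ∀ b {x y} → x < y → appendBit b x < 2 * y
appendBit-< false x<y = *-monoʳ-< 2 x<y
appendBit-< true  {x} {y} x<y = begin-strict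
  suc (2 * x)  <⟨ n<1+n _ ⟩
  2 + 2 * x    ≡⟨ sym (*-suc 2 x) ⟩
  2 * suc x    ≤⟨ *-monoʳ-≤ 2 x<y ⟩
  2 * y        ∎
  where open ≤-Reasoning

appendBit-+ : ∀ b m n → appendBit b (m + n) ≡ 2 * m + appendBit b n
appendBit-+ false m n = *-distribˡ-+ 2 m n
appendBit-+ true  m n = trans (cong suc (*-distribˡ-+ 2 m n)) (sym (+-suc (2 * m) (2 * n)))

levelIndex : List Bool → ℕ
levelIndex []      = 0
levelIndex (b ∷ w) = appendBit b (levelIndex w)

bfsIndex : List Bool → ℕ
bfsIndex []      = 0
bfsIndex (b ∷ w) = suc (appendBit b (bfsIndex w))

levelIndex-< : ∀ w → levelIndex w < 2 ^ length w
levelIndex-< []      = s≤s z≤n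
levelIndex-< (b ∷ w) = appendBit-< b (levelIndex-< w)

levelIndex-injective : ∀ {w w′} → length w ≡ length w′ → levelIndex w ≡ levelIndex w′ → w ≡ w′
levelIndex-injective {[]}    {[]}     _  _  = refl
levelIndex-injective {b ∷ w} {b′ ∷ w′} lw eq with appendBit-injective {b} {b′} eq
... | refl , eq′ = cong (b ∷_) (levelIndex-injective (suc-injective lw) eq′)

bfsIndex-injective : ∀ {w w′} → bfsIndex w ≡ bfsIndex w′ → w ≡ w′
bfsIndex-injective {[]}    {[]}      _  = refl
bfsIndex-injective {b ∷ w} {b′ ∷ w′} eq with appendBit-injective {b} {b′} (suc-injective eq)
... | refl , eq′ = cong (b ∷_) (bfsIndex-injective eq′)

1+bfsIndex≡2^length+levelIndex : ∀ w → suc (bfsIndex w) ≡ 2 ^ length w + levelIndex w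
1+bfsIndex≡2^length+levelIndex []      = refl
1+bfsIndex≡2^length+levelIndex (b ∷ w) = begin
  suc (suc (appendBit b (bfsIndex w)))      ≡⟨ sym (appendBit-+ b 1 (bfsIndex w)) ⟩
  appendBit b (suc (bfsIndex w))            ≡⟨ cong (appendBit b) (1+bfsIndex≡2^length+levelIndex w) ⟩
  appendBit b (2 ^ length w + levelIndex w)   ≡⟨ appendBit-+ b (2 ^ length w) (levelIndex w) ⟩
  2 ^ suc (length w) + levelIndex (b ∷ w) ∎
  where open ≡-Reasoning

-- The edge list of the glued tree

geometric-sum : ∀ r → 2 + sum (map (λ d → 2 ^ suc d) (upTo r)) ≡ 2 ^ suc r
geometric-sum zero    = refl
geometric-sum (suc r) = begin
  2 + sum (map g (upTo (suc r)))                ≡⟨ cong (λ ds → 2 + sum (map g ds)) (sym (upTo-∷ʳ r)) ⟩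
  2 + sum (map g (upTo r ∷ʳ r))                 ≡⟨ cong (λ l → 2 + sum l) (map-++ g (upTo r) (r ∷ [])) ⟩
  2 + sum (map g (upTo r) ++ g r ∷ [])          ≡⟨ cong (2 +_) (sum-++ (map g (upTo r)) (g r ∷ [])) ⟩
  2 + (sum (map g (upTo r)) + (g r + 0))        ≡⟨ regroup 2 (sum (map g (upTo r))) (g r) ⟩
  (2 + sum (map g (upTo r))) + g r              ≡⟨ cong (_+ g r) (geometric-sum r) ⟩
  2 ^ suc r + 2 ^ suc r                         ≡⟨ cong (2 ^ suc r +_) (sym (+-identityʳ (2 ^ suc r))) ⟩
  2 ^ suc (suc r)                               ∎
  where
  open ≡-Reasoning
  g : ℕ → ℕ
  g d = 2 ^ suc d
  regroup : ∀ x y z → x + (y + (z + 0)) ≡ (x + y) + z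
  regroup = solve-∀

sum-map-complement : {A : Set} (g : A → ℕ) {c d : ℕ} (xs : List A) → (∀ x → g x + c ≡ d) →
  sum (map g xs) + length xs * c ≡ length xs * d
sum-map-complement g [] _ = refl
sum-map-complement g {c} {d} (x ∷ xs) gc = begin
  g x + sum (map g xs) + (c + length xs * c)  ≡⟨ regroup (g x) _ c _ ⟩
  (g x + c) + (sum (map g xs) + length xs * c) ≡⟨ cong₂ _+_ (gc x) (sum-map-complement g xs gc) ⟩
  d + length xs * d                            ∎
  where
  open ≡-Reasoning
  regroup : ∀ a b c e → a + b + (c + e) ≡ (a + c) + (b + e)
  regroup = solve-∀

data NodeView {n r : ℕ} (i : Fin n) (w : List Bool) : GTVertex n → Set where
  at-leaf  : length w ≡ r → NodeView i w (leaf w)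
  at-inner : length w ≢ r → NodeView i w (inner i w)

nodeView : ∀ {n} r (i : Fin n) w → NodeView {r = r} i w (node n r i w)
nodeView r i w with length w ≡ᵇ r in eq
... | true  = at-leaf (≡ᵇ⇒≡ (length w) r (subst T (sym eq) _))
... | false = at-inner (λ len → subst T eq (≡⇒≡ᵇ (length w) r len))

module GluedTree (n r : ℕ) where

  E : List (GTVertex n × GTVertex n)
  E = gluedEdges n r

  edge : Fin n → List Bool → Bool → GTVertex n × GTVertex n
  edge i w b = inner i w , node n r i (b ∷ w)

  edge-injective : ∀ {i w b i′ w′ b′} → edge i w b ≡ edge i′ w′ b′ → i ≡ i′ × w ≡ w′ × b ≡ b′
  edge-injective {i} {w} {b} {i′} {w′} {b′} eq
    with node n r i (b ∷ w) | nodeView r i (b ∷ w) | node n r i′ (b′ ∷ w′) | nodeView r i′ (b′ ∷ w′) | eq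
  ... | _ | at-leaf _  | _ | at-leaf _  | refl = refl , refl , refl
  ... | _ | at-inner _ | _ | at-inner _ | refl = refl , refl , refl

  node-leaf : ∀ i w → length w ≡ r → node n r i w ≡ leaf w
  node-leaf i w len with node n r i w | nodeView r i w
  ... | _ | at-leaf _   = refl
  ... | _ | at-inner ≢r = ⊥-elim (≢r len)

  node-inner : ∀ i w → length w ≢ r → node n r i w ≡ inner i w
  node-inner i w ≢r with node n r i w | nodeView r i w
  ... | _ | at-leaf len = ⊥-elim (≢r len)
  ... | _ | at-inner _  = refl

  node≡inner⁻ : ∀ {i w j u} → node n r i w ≡ inner j u → i ≡ j × w ≡ u × length w ≢ r
  node≡inner⁻ {i} {w} eq with node n r i w | nodeView r i w | eq
  ... | _ | at-inner ≢r | refl = refl , refl , ≢r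

  node≡leaf⁻ : ∀ {i w u} → node n r i w ≡ leaf u → w ≡ u × length w ≡ r
  node≡leaf⁻ {i} {w} eq with node n r i w | nodeView r i w | eq
  ... | _ | at-leaf len | refl = refl , len

  childEdges : Fin n → List Bool → List (GTVertex n × GTVertex n)
  childEdges i w = map (edge i w) (false ∷ true ∷ [])

  levelEdges : Fin n → ℕ → List (GTVertex n × GTVertex n)
  levelEdges i d = concatMap (childEdges i) (allStrings d)

  copyEdges : Fin n → List (GTVertex n × GTVertex n)
  copyEdges i = concatMap (levelEdges i) (upTo r)

  ∈-childEdges : ∀ i w b → edge i w b ∈ childEdges i w
  ∈-childEdges i w false = here refl
  ∈-childEdges i w true  = there (here refl)

  ∈-levelEdges⁻ : ∀ {i d y} → y ∈ levelEdges i d → ∃[ w ] ∃[ b ] (length w ≡ d × y ≡ edge i w b)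
  ∈-levelEdges⁻ {i} {d} y∈ with find (∈-concatMap⁻ (childEdges i) {xs = allStrings d} y∈)
  ... | w , w∈ , here refl         = w , false , allStrings-length d w∈ , refl
  ... | w , w∈ , there (here refl) = w , true  , allStrings-length d w∈ , refl

  ∈-copyEdges⁻ : ∀ {i y} → y ∈ copyEdges i → ∃[ w ] ∃[ b ] (length w < r × y ≡ edge i w b)
  ∈-copyEdges⁻ {i} y∈ with find (∈-concatMap⁻ (levelEdges i) {xs = upTo r} y∈)
  ... | d , d∈ , y∈′ with ∈-levelEdges⁻ {i} {d} y∈′
  ... | w , b , refl , y≡ = w , b , ∈-upTo⁻ d∈ , y≡

  ∈-edges⁻ : ∀ {y} → y ∈ E → ∃[ i ] ∃[ w ] ∃[ b ] (length w < r × y ≡ edge i w b)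
  ∈-edges⁻ y∈ with find (∈-concatMap⁻ copyEdges {xs = allFin n} y∈)
  ... | i , _ , y∈′ = i , ∈-copyEdges⁻ y∈′

  ∈-edges⁺ : ∀ i w b → length w < r → edge i w b ∈ E
  ∈-edges⁺ i w b w<r =
    ∈-concatMap⁺ copyEdges (Any.map (λ { refl → ∈-copy }) (∈-allFin i))
    where
    ∈-level : edge i w b ∈ levelEdges i (length w)
    ∈-level = ∈-concatMap⁺ (childEdges i) (Any.map (λ { refl → ∈-childEdges i w b }) (allStrings-complete w))
    ∈-copy : edge i w b ∈ copyEdges i
    ∈-copy = ∈-concatMap⁺ (levelEdges i) (Any.map (λ { refl → ∈-level }) (∈-upTo⁺ w<r))

  source : GTVertex n × GTVertex n → List Bool
  source (inner _ w , _) = w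
  source (leaf w , _)    = w

  copy : GTVertex n × GTVertex n → ℕ
  copy (inner i _ , _) = Fin.toℕ i
  copy (leaf _ , _)    = 0

  childEdges-unique : ∀ i w → Unique (childEdges i w)
  childEdges-unique i w =
    Uniqueₚ.map⁺ (λ eq → proj₂ (proj₂ (edge-injective {i} {w} {_} {i} {w} eq))) (((λ ()) ∷ []) ∷ [] ∷ [])

  levelEdges-unique : ∀ i d → Unique (levelEdges i d)
  levelEdges-unique i d =
    concatMap-unique (childEdges i) source (λ w → w) (allStrings d)
      (subst Unique (sym (map-id _)) (allStrings-unique d)) (λ _ → refl ∷ refl ∷ [])
      (childEdges-unique i)

  copyEdges-unique : ∀ i → Unique (copyEdges i)
  copyEdges-unique i =
    concatMap-unique (levelEdges i) (length ∘ source) (λ d → d) (upTo r)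
      (subst Unique (sym (map-id _)) (Uniqueₚ.upTo⁺ r))
      (λ d → All.tabulate λ y∈ → case ∈-levelEdges⁻ {i} {d} y∈ of λ { (_ , _ , len , refl) → len })
      (levelEdges-unique i)

  edges-unique : Unique E
  edges-unique =
    concatMap-unique copyEdges copy Fin.toℕ (allFin n)
      (Uniqueₚ.map⁺ Finₚ.toℕ-injective (Uniqueₚ.allFin⁺ n))
      (λ i → All.tabulate λ y∈ → case ∈-copyEdges⁻ {i} y∈ of λ { (_ , _ , _ , refl) → refl })
      copyEdges-unique

  length-edges : length E + n * 2 ≡ n * 2 ^ suc r
  length-edges = begin
    length E + n * 2
      ≡⟨ cong₂ _+_ (length-concatMap copyEdges (allFin n)) (cong (_* 2) (sym length-allFin)) ⟩
    sum (map (length ∘ copyEdges) (allFin n)) + length (allFin n) * 2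
      ≡⟨ sum-map-complement (length ∘ copyEdges) (allFin n) length-copyEdges ⟩
    length (allFin n) * 2 ^ suc r
      ≡⟨ cong (_* 2 ^ suc r) length-allFin ⟩
    n * 2 ^ suc r ∎
    where
    open ≡-Reasoning
    length-allFin : length (allFin n) ≡ n
    length-allFin = length-tabulate (λ i → i)
    length-levelEdges : ∀ i d → length (levelEdges i d) ≡ 2 ^ suc d
    length-levelEdges i d = begin
      length (levelEdges i d)                 ≡⟨ length-concatMap (childEdges i) (allStrings d) ⟩
      sum (map (λ _ → 2) (allStrings d))      ≡⟨ sum-map-const _ (allStrings d) (λ _ → refl) ⟩
      length (allStrings d) * 2               ≡⟨ cong (_* 2) (length-allStrings d) ⟩
      2 ^ d * 2                               ≡⟨ *-comm (2 ^ d) 2 ⟩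
      2 ^ suc d                               ∎
    length-copyEdges : ∀ i → length (copyEdges i) + 2 ≡ 2 ^ suc r
    length-copyEdges i = begin
      length (copyEdges i) + 2                                ≡⟨ +-comm (length (copyEdges i)) 2 ⟩
      2 + length (copyEdges i)                                ≡⟨ cong (2 +_) (length-concatMap (levelEdges i) (upTo r)) ⟩
      2 + sum (map (length ∘ levelEdges i) (upTo r))
        ≡⟨ cong (λ l → 2 + sum l) (map-cong (length-levelEdges i) (upTo r)) ⟩
      2 + sum (map (λ d → 2 ^ suc d) (upTo r))                ≡⟨ geometric-sum r ⟩
      2 ^ suc r                                               ∎

  Touches : GTVertex n → GTVertex n × GTVertex n → Set
  Touches v y = proj₁ y ≡ v ⊎ proj₂ y ≡ v

  innerEdgesAt : Fin n → List Bool → List (GTVertex n × GTVertex n)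
  innerEdgesAt j []      = childEdges j []
  innerEdgesAt j (c ∷ u) = edge j u c ∷ childEdges j (c ∷ u)

  leafEdgesAt : List Bool → List (GTVertex n × GTVertex n)
  leafEdgesAt []      = []
  leafEdgesAt (c ∷ u) = map (λ i → edge i u c) (allFin n)

  touches-inner : ∀ {j u y} → y ∈ E → Touches (inner j u) y → length u < r × y ∈ innerEdgesAt j u
  touches-inner {j} {u} y∈ touch with ∈-edges⁻ y∈
  ... | i , w , b , w<r , refl with touch
  ... | inj₁ refl = w<r , from-parent w
    where
    from-parent : ∀ w → edge j w b ∈ innerEdgesAt j w
    from-parent []      = ∈-childEdges j [] b
    from-parent (_ ∷ _) = there (∈-childEdges j _ b)
  ... | inj₂ child≡ with node≡inner⁻ child≡
  ...   | refl , refl , ≢r = ≤∧≢⇒< w<r ≢r , here refl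

  touches-leaf : ∀ {u y} → y ∈ E → Touches (leaf u) y → length u ≡ r × y ∈ leafEdgesAt u
  touches-leaf y∈ touch with ∈-edges⁻ y∈
  ... | i , w , b , _ , refl with touch
  ... | inj₂ child≡ with node≡leaf⁻ child≡
  ...   | refl , len = len , ∈-map⁺ (λ i → edge i w b) (∈-allFin i)

  childEdges-⊆ : ∀ i w → length w < r → All (_∈ E) (childEdges i w)
  childEdges-⊆ i w w<r = ∈-edges⁺ i w false w<r ∷ ∈-edges⁺ i w true w<r ∷ []

  innerEdgesAt-unique : ∀ j u → Unique (innerEdgesAt j u)
  innerEdgesAt-unique j []      = childEdges-unique j []
  innerEdgesAt-unique j (c ∷ u) = (parent≢child false ∷ parent≢child true ∷ []) ∷ childEdges-unique j (c ∷ u)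
    where
    parent≢child : ∀ b → edge j u c ≢ edge j (c ∷ u) b
    parent≢child b eq = <⇒≢ (n<1+n (length u)) (cong length (proj₁ (proj₂ (edge-injective eq))))

  innerEdgesAt-⊆ : ∀ j u → length u < r → All (_∈ E) (innerEdgesAt j u)
  innerEdgesAt-⊆ j []      u<r = childEdges-⊆ j [] u<r
  innerEdgesAt-⊆ j (c ∷ u) u<r = ∈-edges⁺ j u c (<-trans (n<1+n (length u)) u<r) ∷ childEdges-⊆ j (c ∷ u) u<r

  leafEdgesAt-unique : ∀ u → Unique (leafEdgesAt u)
  leafEdgesAt-unique []      = []
  leafEdgesAt-unique (c ∷ u) = Uniqueₚ.map⁺ (λ eq → proj₁ (edge-injective eq)) (Uniqueₚ.allFin⁺ n)

  leafEdgesAt-⊆ : ∀ u → length u ≡ r → All (_∈ E) (leafEdgesAt u)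
  leafEdgesAt-⊆ []      _   = []
  leafEdgesAt-⊆ (c ∷ u) len =
    Allₚ.map⁺ (All.tabulate λ {i} _ → ∈-edges⁺ i u c (subst (length u <_) len (n<1+n (length u))))

-- Palettes

record IsPalette (n : ℕ) (P : Bool → Fin n → ℕ) : Set where
  field
    range       : ∀ b i → 1 ≤ P b i × P b i ≤ 2 * n
    injective   : ∀ b i b′ i′ → P b i ≡ P b′ i′ → b ≡ b′ × i ≡ i′
    pairSum≢    : ∀ i → P false i + P true i ≢ n + suc (Fin.toℕ i)
    dissociated : ∀ b (k : Fin (suc n)) → Dissociated (map (2 * n * Fin.toℕ k +_) (map (P b) (allFin n)))

all-Bool? : {Q : Bool → Set} → (∀ b → Dec (Q b)) → Dec (∀ b → Q b)
all-Bool? Q? = map′ (λ (qf , qt) → λ { false → qf ; true → qt }) (λ q → q false , q true) (Q? false ×-dec Q? true)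

isPalette? : ∀ {n} (P : Bool → Fin n → ℕ) → Dec (IsPalette n P)
isPalette? {n} P =
  map′ (λ (ra , inj , ps , di) → record { range = ra ; injective = inj ; pairSum≢ = ps ; dissociated = di })
    (λ p → let open IsPalette p in range , injective , pairSum≢ , dissociated)
    (range? ×-dec injective? ×-dec pairSum? ×-dec shifts?)
  where
  range? : Dec (∀ b i → 1 ≤ P b i × P b i ≤ 2 * n)
  range? = all-Bool? λ b → Finₚ.all? λ i → (1 ≤? P b i) ×-dec (P b i ≤? 2 * n)
  injective? : Dec (∀ b i b′ i′ → P b i ≡ P b′ i′ → b ≡ b′ × i ≡ i′)
  injective? = all-Bool? λ b → Finₚ.all? λ i → all-Bool? λ b′ → Finₚ.all? λ i′ →
    (P b i ≟ P b′ i′) →-dec ((b Boolₚ.≟ b′) ×-dec (i Fin.≟ i′))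
  pairSum? : Dec (∀ i → P false i + P true i ≢ n + suc (Fin.toℕ i))
  pairSum? = Finₚ.all? λ i → ¬? (P false i + P true i ≟ n + suc (Fin.toℕ i))
  shifts? : Dec (∀ b (k : Fin (suc n)) → Dissociated (map (2 * n * Fin.toℕ k +_) (map (P b) (allFin n))))
  shifts? = all-Bool? λ b → Finₚ.all? λ k → dissociated? _

palette-shifts-dissociated : ∀ {n P} → IsPalette n P → 0 < n →
  ∀ b k → Dissociated (map (2 * n * k +_) (map (P b) (allFin n)))
palette-shifts-dissociated {n} {P} palette 0<n b =
  shifts-dissociated (2 * n) (suc n) colours<2n[n+1] (IsPalette.dissociated palette b)
  where
  colours<2n[n+1] : sum (map (P b) (allFin n)) < 2 * n * suc n
  colours<2n[n+1] = begin-strict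
    sum (map (P b) (allFin n))  ≤⟨ sum-map-≤ (P b) (allFin n) (proj₂ ∘ IsPalette.range palette b) ⟩
    length (allFin n) * (2 * n) ≡⟨ cong (_* (2 * n)) (length-tabulate {n = n} (λ i → i)) ⟩
    n * (2 * n)                 ≡⟨ *-comm n (2 * n) ⟩
    2 * n * n                   <⟨ m<n+m (2 * n * n) (*-monoʳ-< 2 0<n) ⟩
    2 * n + 2 * n * n           ≡⟨ sym (*-suc (2 * n) n) ⟩
    2 * n * suc n               ∎
    where open ≤-Reasoning

-- The labelling

sum-of-two-above : ∀ {N a b c} → N < a → N < b → c ≤ N + N → c ≢ a + b
sum-of-two-above N<a N<b c≤2N = <⇒≢ (≤-<-trans c≤2N (+-mono-< N<a N<b))

parentLabel-shape : ∀ n {Q K t x} s → Q ≡ suc K + t → x + 2 ≡ Q + K →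
  2 * n * Q + (n * x + s) ≡ 4 * n * K + (3 * n * t + n + s)
parentLabel-shape n {Q} {K} {t} {x} s refl x+2≡Q+K = +-cancelʳ-≡ n _ _ (begin
  2 * n * Q + (n * x + s) + n          ≡⟨ regroup₁ n Q x s ⟩
  2 * n * Q + n * (x + 1) + s          ≡⟨ cong (λ y → 2 * n * Q + n * y + s) x+1≡2K+t ⟩
  2 * n * Q + n * (2 * K + t) + s      ≡⟨ regroup₂ n K t s ⟩
  4 * n * K + (3 * n * t + n + s) + n  ∎)
  where
  open ≡-Reasoning
  x+1≡2K+t : x + 1 ≡ 2 * K + t
  x+1≡2K+t = suc-injective (begin
    suc (x + 1)        ≡⟨ trans (cong suc (+-comm x 1)) (sym (+-comm x 2)) ⟩
    x + 2              ≡⟨ x+2≡Q+K ⟩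
    suc K + t + K      ≡⟨ regroup₃ K t ⟩
    suc (2 * K + t)    ∎)
    where
    regroup₃ : ∀ K t → suc K + t + K ≡ suc (2 * K + t)
    regroup₃ = solve-∀
  regroup₁ : ∀ n Q x s → 2 * n * Q + (n * x + s) + n ≡ 2 * n * Q + n * (x + 1) + s
  regroup₁ = solve-∀
  regroup₂ : ∀ n K t s → 2 * n * (suc K + t) + n * (2 * K + t) + s ≡ 4 * n * K + (3 * n * t + n + s) + n
  regroup₂ = solve-∀

3nt+n+s≢ : ∀ n t {s p} → p ≤ 4 * n → p ≢ n + s → 0 < s → 3 * n * t + n + s ≢ p
3nt+n+s≢ n zero    {s} p≤4n p≢n+s _ eq = p≢n+s (trans (sym eq) (cong (λ z → z + n + s) (*-zeroʳ (3 * n))))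
3nt+n+s≢ n (suc t) {s} {p} p≤4n _ 0<s eq = <⇒≢ (≤-<-trans p≤4n 4n<lhs) (sym eq)
  where
  4n<lhs : 4 * n < 3 * n * suc t + n + s
  4n<lhs = begin-strict
    4 * n                    ≡⟨ regroup n ⟩
    3 * n * 1 + n            <⟨ m<m+n (3 * n * 1 + n) 0<s ⟩
    3 * n * 1 + n + s        ≤⟨ +-monoˡ-≤ s (+-monoˡ-≤ n (*-monoʳ-≤ (3 * n) (s≤s z≤n))) ⟩
    3 * n * suc t + n + s    ∎
    where
    open ≤-Reasoning
    regroup : ∀ n → 4 * n ≡ 3 * n * 1 + n
    regroup = solve-∀

module Labelling (n r′ : ℕ) (0<n : 0 < n) (P : Bool → Fin n → ℕ) (palette : IsPalette n P) where

  open IsPalette palette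
  open GluedTree n (suc r′)

  Q : ℕ
  Q = 2 ^ r′

  M : ℕ
  M = length E

  leafLabel : Fin n → List Bool → Bool → ℕ
  leafLabel i w b = 2 * n * levelIndex w + P b i

  innerLabel : Fin n → List Bool → Bool → ℕ
  innerLabel i w b = 2 * n * Q + (n * appendBit b (bfsIndex w) + suc (Fin.toℕ i))

  label : GTVertex n × GTVertex n → ℕ
  label (inner i w , leaf (b ∷ _))    = leafLabel i w b
  label (inner i w , inner _ (b ∷ _)) = innerLabel i w b
  label _                              = 0

  label-leaf : ∀ i w b → length w ≡ r′ → label (edge i w b) ≡ leafLabel i w b
  label-leaf i w b len rewrite node-leaf i (b ∷ w) (cong suc len) = refl

  label-inner : ∀ i w b → length w < r′ → label (edge i w b) ≡ innerLabel i w b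
  label-inner i w b w<r′ rewrite node-inner i (b ∷ w) (<⇒≢ w<r′ ∘ suc-injective) = refl

  M+2n≡4nQ : M + n * 2 ≡ n * (2 * (2 * Q))
  M+2n≡4nQ = length-edges

  leafLabel-≤ : ∀ i w b → length w ≡ r′ → leafLabel i w b ≤ 2 * n * Q
  leafLabel-≤ i w b refl = begin
    2 * n * K + P b i  ≤⟨ +-monoʳ-≤ (2 * n * K) (proj₂ (range b i)) ⟩
    2 * n * K + 2 * n  ≡⟨ trans (+-comm (2 * n * K) (2 * n)) (sym (*-suc (2 * n) K)) ⟩
    2 * n * suc K      ≤⟨ *-monoʳ-≤ (2 * n) (levelIndex-< w) ⟩
    2 * n * Q          ∎
    where
    open ≤-Reasoning
    K : ℕ
    K = levelIndex w

  innerLabel-> : ∀ i w b → 2 * n * Q < innerLabel i w b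
  innerLabel-> i w b = m<m+n (2 * n * Q) (<-≤-trans z<s (m≤n+m (suc (Fin.toℕ i)) (n * appendBit b (bfsIndex w))))

  innerLabel-≤ : ∀ i w b → length w < r′ → innerLabel i w b + n * 2 ≤ n * (2 * (2 * Q))
  innerLabel-≤ i w b w<r′ = begin
    2 * n * Q + (n * x + suc (Fin.toℕ i)) + n * 2
      ≤⟨ +-monoˡ-≤ (n * 2) (+-monoʳ-≤ (2 * n * Q) (+-monoʳ-≤ (n * x) (Finₚ.toℕ<n i))) ⟩
    2 * n * Q + (n * x + n) + n * 2  ≡⟨ regroup₁ n Q x ⟩
    2 * n * Q + n * (3 + x)          ≤⟨ +-monoʳ-≤ (2 * n * Q) (*-monoʳ-≤ n x+3≤2Q) ⟩
    2 * n * Q + n * (2 * Q)          ≡⟨ regroup₂ n Q ⟩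
    n * (2 * (2 * Q))                ∎
    where
    open ≤-Reasoning
    x : ℕ
    x = appendBit b (bfsIndex w)
    x+3≤2Q : 3 + x ≤ 2 * Q
    x+3≤2Q = begin-strict
      2 + x                                 ≡⟨ 1+bfsIndex≡2^length+levelIndex (b ∷ w) ⟩
      2 ^ length (b ∷ w) + levelIndex (b ∷ w)      <⟨ +-monoʳ-< (2 ^ length (b ∷ w)) (levelIndex-< (b ∷ w)) ⟩
      2 ^ length (b ∷ w) + 2 ^ length (b ∷ w) ≡⟨ cong (2 ^ length (b ∷ w) +_) (sym (+-identityʳ _)) ⟩
      2 * 2 ^ length (b ∷ w)                ≤⟨ *-monoʳ-≤ 2 (^-monoʳ-≤ 2 w<r′) ⟩
      2 * Q                                 ∎
    regroup₁ : ∀ n Q x → 2 * n * Q + (n * x + n) + n * 2 ≡ 2 * n * Q + n * (3 + x)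
    regroup₁ = solve-∀
    regroup₂ : ∀ n Q → 2 * n * Q + n * (2 * Q) ≡ n * (2 * (2 * Q))
    regroup₂ = solve-∀

  2nQ≤M : 2 * n * Q ≤ M
  2nQ≤M = +-cancelʳ-≤ (n * 2) _ _ (begin
    2 * n * Q + n * 2      ≤⟨ +-monoʳ-≤ (2 * n * Q) (subst (_≤ 2 * n * Q) (*-comm 2 n) 2n≤2nQ) ⟩
    2 * n * Q + 2 * n * Q  ≡⟨ regroup n Q ⟩
    n * (2 * (2 * Q))      ≡⟨ sym M+2n≡4nQ ⟩
    M + n * 2              ∎)
    where
    open ≤-Reasoning
    2n≤2nQ : 2 * n ≤ 2 * n * Q
    2n≤2nQ = m≤m*n (2 * n) Q {{m^n≢0 2 r′}}
    regroup : ∀ n Q → 2 * n * Q + 2 * n * Q ≡ n * (2 * (2 * Q))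
    regroup = solve-∀

  label-range : ∀ {y} → y ∈ E → 1 ≤ label y × label y ≤ M
  label-range y∈ with ∈-edges⁻ y∈
  ... | i , w , b , w<r , refl with m<1+n⇒m<n∨m≡n w<r
  ...   | inj₂ len rewrite label-leaf i w b len =
    ≤-trans (proj₁ (range b i)) (m≤n+m (P b i) _) , ≤-trans (leafLabel-≤ i w b len) 2nQ≤M
  ...   | inj₁ w<r′ rewrite label-inner i w b w<r′ =
    <-≤-trans z<s (innerLabel-> i w b) ,
    +-cancelʳ-≤ (n * 2) _ _ (subst (innerLabel i w b + n * 2 ≤_) (sym M+2n≡4nQ) (innerLabel-≤ i w b w<r′))

  leafLabel-injective : ∀ {i w b i′ w′ b′} → length w ≡ r′ → length w′ ≡ r′ →
    leafLabel i w b ≡ leafLabel i′ w′ b′ → edge i w b ≡ edge i′ w′ b′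
  leafLabel-injective {i} {w} {b} {i′} {w′} {b′} len len′ eq
    with *+-injective⁺ (2 * n) (proj₁ (range b i)) (proj₂ (range b i)) (proj₁ (range b′ i′)) (proj₂ (range b′ i′))
           eq
  ... | same-levelIndex , same-colour with injective b i b′ i′ same-colour
  ...   | refl , refl = cong (λ v → edge i v b) (levelIndex-injective (trans len (sym len′)) same-levelIndex)

  innerLabel-injective : ∀ {i w b i′ w′ b′} → innerLabel i w b ≡ innerLabel i′ w′ b′ →
    edge i w b ≡ edge i′ w′ b′
  innerLabel-injective {i} {w} {b} {i′} {w′} {b′} eq
    with *+-injective⁺ n z<s (Finₚ.toℕ<n i) z<s (Finₚ.toℕ<n i′) (+-cancelˡ-≡ (2 * n * Q) _ _ eq)
  ... | same-index , same-copy with appendBit-injective {b} {b′} same-index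
  ...   | refl , same-bfsIndex =
    cong₂ (λ j v → edge j v b) (Finₚ.toℕ-injective (suc-injective same-copy)) (bfsIndex-injective same-bfsIndex)

  label-injective : ∀ {y y′} → y ∈ E → y′ ∈ E → label y ≡ label y′ → y ≡ y′
  label-injective y∈ y′∈ eq with ∈-edges⁻ y∈ | ∈-edges⁻ y′∈
  ... | i , w , b , w<r , refl | i′ , w′ , b′ , w′<r , refl
    with m<1+n⇒m<n∨m≡n w<r | m<1+n⇒m<n∨m≡n w′<r
  ...   | inj₂ len | inj₂ len′ =
    leafLabel-injective len len′ (trans (sym (label-leaf i w b len)) (trans eq (label-leaf i′ w′ b′ len′)))
  ...   | inj₁ lt | inj₁ lt′ =
    innerLabel-injective (trans (sym (label-inner i w b lt)) (trans eq (label-inner i′ w′ b′ lt′)))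
  ...   | inj₂ len | inj₁ lt′ = ⊥-elim (<⇒≢ (≤-<-trans (leafLabel-≤ i w b len) (innerLabel-> i′ w′ b′))
    (trans (sym (label-leaf i w b len)) (trans eq (label-inner i′ w′ b′ lt′))))
  ...   | inj₁ lt | inj₂ len′ = ⊥-elim (<⇒≢ (≤-<-trans (leafLabel-≤ i′ w′ b′ len′) (innerLabel-> i w b))
    (sym (trans (sym (label-inner i w b lt)) (trans eq (label-leaf i′ w′ b′ len′)))))

  parent≢children : ∀ j c u → length (c ∷ u) ≡ r′ →
    innerLabel j u c ≢ leafLabel j (c ∷ u) false + leafLabel j (c ∷ u) true
  parent≢children j c u len eq = 3nt+n+s≢ n t colours≤4n (pairSum≢ j) z<s (+-cancelˡ-≡ (4 * n * K) _ _ (begin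
    4 * n * K + (3 * n * t + n + suc (Fin.toℕ j))
      ≡⟨ sym (parentLabel-shape n (suc (Fin.toℕ j)) Q≡1+K+t x+2≡Q+K) ⟩
    innerLabel j u c
      ≡⟨ eq ⟩
    leafLabel j (c ∷ u) false + leafLabel j (c ∷ u) true
      ≡⟨ regroup n K (P false j) (P true j) ⟩
    4 * n * K + (P false j + P true j) ∎))
    where
    open ≡-Reasoning
    K : ℕ
    K = levelIndex (c ∷ u)
    x+2≡Q+K : appendBit c (bfsIndex u) + 2 ≡ Q + K
    x+2≡Q+K = trans (+-comm _ 2) (trans (1+bfsIndex≡2^length+levelIndex (c ∷ u)) (cong (λ d → 2 ^ d + K) len))
    K<Q : K < Q
    K<Q = subst (K <_) (cong (2 ^_) len) (levelIndex-< (c ∷ u))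
    t : ℕ
    t = proj₁ (m≤n⇒∃[o]m+o≡n K<Q)
    Q≡1+K+t : Q ≡ suc K + t
    Q≡1+K+t = sym (proj₂ (m≤n⇒∃[o]m+o≡n K<Q))
    colours≤4n : P false j + P true j ≤ 4 * n
    colours≤4n = subst (P false j + P true j ≤_) (double n) (+-mono-≤ (proj₂ (range false j)) (proj₂ (range true j)))
      where
      double : ∀ n → 2 * n + 2 * n ≡ 4 * n
      double = solve-∀
    regroup : ∀ n K a b → 2 * n * K + a + (2 * n * K + b) ≡ 4 * n * K + (a + b)
    regroup = solve-∀

  f : Fin M → ℕ
  f = label ∘ lookup E

  label-pos : ∀ {y} → y ∈ E → 0 < label y
  label-pos = proj₁ ∘ label-range

  label-≢ : ∀ {y y′} → y ∈ E → y′ ∈ E → y ≢ y′ → label y ≢ label y′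
  label-≢ y∈ y′∈ y≢y′ = y≢y′ ∘ label-injective y∈ y′∈

  no-label-is-sum : ∀ j c u → length (c ∷ u) < suc r′ →
    let p = label (edge j u c) ; x = label (edge j (c ∷ u) false) ; y = label (edge j (c ∷ u) true)
    in (p ≢ x + y) × (x ≢ p + y) × (y ≢ p + x)
  no-label-is-sum j c u u<r with m<1+n⇒m<n∨m≡n u<r
  ... | inj₁ u<r′
    rewrite label-inner j u c (<-trans (n<1+n (length u)) u<r′)
          | label-inner j (c ∷ u) false u<r′ | label-inner j (c ∷ u) true u<r′ =
    sum-of-two-above (innerLabel-> j (c ∷ u) false) (innerLabel-> j (c ∷ u) true)
      (below-4nQ (innerLabel-≤ j u c (<-trans (n<1+n (length u)) u<r′))) ,
    sum-of-two-above (innerLabel-> j u c) (innerLabel-> j (c ∷ u) true)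
      (below-4nQ (innerLabel-≤ j (c ∷ u) false u<r′)) ,
    sum-of-two-above (innerLabel-> j u c) (innerLabel-> j (c ∷ u) false)
      (below-4nQ (innerLabel-≤ j (c ∷ u) true u<r′))
    where
    below-4nQ : ∀ {a} → a + n * 2 ≤ n * (2 * (2 * Q)) → a ≤ 2 * n * Q + 2 * n * Q
    below-4nQ {a} a≤ = ≤-trans (m≤m+n a (n * 2)) (subst (a + n * 2 ≤_) (regroup n Q) a≤)
      where
      regroup : ∀ n Q → n * (2 * (2 * Q)) ≡ 2 * n * Q + 2 * n * Q
      regroup = solve-∀
  ... | inj₂ len
    rewrite label-inner j u c (subst (length u <_) len (n<1+n (length u)))
          | label-leaf j (c ∷ u) false len | label-leaf j (c ∷ u) true len =
    parent≢children j c u len ,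
    leaf≢parent+ (leafLabel-≤ j (c ∷ u) false len) ,
    leaf≢parent+ (leafLabel-≤ j (c ∷ u) true len)
    where
    leaf≢parent+ : ∀ {a z} → a ≤ 2 * n * Q → a ≢ innerLabel j u c + z
    leaf≢parent+ {a} {z} a≤ = <⇒≢ (<-≤-trans (≤-<-trans a≤ (innerLabel-> j u c)) (m≤m+n _ z))

  innerLabels-dissociated : ∀ j u → length u < suc r′ → Dissociated (map label (innerEdgesAt j u))
  innerLabels-dissociated j [] u<r with innerEdgesAt-⊆ j [] u<r | innerEdgesAt-unique j []
  ... | x∈ ∷ y∈ ∷ [] | (x≢y ∷ []) ∷ _ =
    pair-dissociated (label-pos x∈) (label-pos y∈) (label-≢ x∈ y∈ x≢y)
  innerLabels-dissociated j (c ∷ u) u<r with innerEdgesAt-⊆ j (c ∷ u) u<r | innerEdgesAt-unique j (c ∷ u)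
  ... | p∈ ∷ x∈ ∷ y∈ ∷ [] | (p≢x ∷ p≢y ∷ []) ∷ (x≢y ∷ []) ∷ _ =
    let (p≢x+y , x≢p+y , y≢p+x) = no-label-is-sum j c u u<r in
    triple-dissociated (label-pos p∈) (label-pos x∈) (label-pos y∈)
      (label-≢ p∈ x∈ p≢x) (label-≢ p∈ y∈ p≢y) (label-≢ x∈ y∈ x≢y) p≢x+y x≢p+y y≢p+x

  leafLabels-dissociated : ∀ u → length u ≡ suc r′ → Dissociated (map label (leafEdgesAt u))
  leafLabels-dissociated []      ()
  leafLabels-dissociated (c ∷ u) len =
    subst Dissociated (sym shifted-colours) (palette-shifts-dissociated palette 0<n c (levelIndex u))
    where
    shifted-colours : map label (leafEdgesAt (c ∷ u)) ≡ map (2 * n * levelIndex u +_) (map (P c) (allFin n))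
    shifted-colours = begin
      map label (map (λ i → edge i u c) (allFin n))
        ≡⟨ sym (map-∘ (allFin n)) ⟩
      map (λ i → label (edge i u c)) (allFin n)
        ≡⟨ map-cong (λ i → label-leaf i u c (suc-injective len)) (allFin n) ⟩
      map (λ i → 2 * n * levelIndex u + P c i) (allFin n)
        ≡⟨ map-∘ (allFin n) ⟩
      map (2 * n * levelIndex u +_) (map (P c) (allFin n)) ∎
      where open ≡-Reasoning

  isolated : ∀ {v} → (∀ {y} → y ∈ E → ¬ Touches v y) → IsARVertex E f v
  isolated {v} untouched = isARVertex-from-edges E edges-unique label v [] []
    (λ e incident → ⊥-elim (untouched (∈-lookup e) incident)) []-dissociated

  isARVertex : ∀ v → IsARVertex E f v
  isARVertex (inner j u) with length u <? suc r′
  ... | yes u<r = isARVertex-from-edges E edges-unique label (inner j u)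
    (innerEdgesAt-⊆ j u u<r) (innerEdgesAt-unique j u)
    (λ e incident → proj₂ (touches-inner (∈-lookup e) incident)) (innerLabels-dissociated j u u<r)
  ... | no u≮r = isolated (λ y∈ touch → u≮r (proj₁ (touches-inner y∈ touch)))
  isARVertex (leaf u) with length u ≟ suc r′
  ... | yes len = isARVertex-from-edges E edges-unique label (leaf u)
    (leafEdgesAt-⊆ u len) (leafEdgesAt-unique u)
    (λ e incident → proj₂ (touches-leaf (∈-lookup e) incident)) (leafLabels-dissociated u len)
  ... | no len≢ = isolated (λ y∈ touch → len≢ (proj₁ (touches-leaf y∈ touch)))

  isARGraph : IsARGraph E
  isARGraph =
    f , (λ e → label-range (∈-lookup e)) ,
    (λ {e} {e′} eq → lookup-injective edges-unique e e′ (label-injective (∈-lookup e) (∈-lookup e′) eq)) ,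
    isARVertex

gluedTree-isARGraph : ∀ {n} r′ → 0 < n → (P : Bool → Fin n → ℕ) → True (isPalette? P) →
  IsARGraph (gluedEdges n (suc r′))
gluedTree-isARGraph {n} r′ 0<n P palette = Labelling.isARGraph n r′ 0<n P (toWitness palette)

colouring : ∀ {n} → Vec ℕ n → Vec ℕ n → Bool → Fin n → ℕ
colouring lower upper false = Vec.lookup lower
colouring lower upper true  = Vec.lookup upper

theorem6 : (r n : ℕ) → 1 ≤ r → 1 ≤ n → n ≤ 4 → IsARGraph (gluedEdges n r)
theorem6 zero     _ () _ _
theorem6 (suc _)  0 _ () _
theorem6 (suc r′) 1 _ _ _ = gluedTree-isARGraph r′ z<s (colouring (1 ∷ [])             (2 ∷ [])) _
theorem6 (suc r′) 2 _ _ _ = gluedTree-isARGraph r′ z<s (colouring (1 ∷ 2 ∷ [])         (3 ∷ 4 ∷ [])) _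
theorem6 (suc r′) 3 _ _ _ = gluedTree-isARGraph r′ z<s (colouring (1 ∷ 2 ∷ 4 ∷ [])     (5 ∷ 6 ∷ 3 ∷ [])) _
theorem6 (suc r′) 4 _ _ _ = gluedTree-isARGraph r′ z<s (colouring (1 ∷ 2 ∷ 4 ∷ 8 ∷ []) (3 ∷ 5 ∷ 6 ∷ 7 ∷ [])) _
theorem6 (suc _)  (suc (suc (suc (suc (suc _))))) _ _ (s≤s (s≤s (s≤s (s≤s ()))))
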